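{- Let $k,\sigma\ge1$. A set $\Pi$ of Parikh vectors of order $k$ over an alphabet of size $\sigma$ is realizable if and only if the subgraph of the Parikh-de-Bruijn grid of order $k$ induced by $\Pi$ is connected.
   Context: Let $\Sigma=\{a_1<\dots<a_\sigma\}$. For a string $u$, $\mathbf{pv}(u)\in\mathbb{N}^\sigma$ has $i$-th entry the number of occurrences of $a_i$ in $u$; the order of a Parikh vector is the sum of its entries; $\mathrm{PV}(k,\sigma)$ is the set of order-$k$ Parikh vectors; $e_i=\mathbf{pv}(a_i)$. Two order-$k$ Parikh vectors $p,q$ are neighbors if $q=p-e_i+e_j$ for some $i\neq j$. The Parikh-de-Bruijn grid of order $k$ is the graph with vertex set $\mathrm{PV}(k,\sigma)$ in which two vertices are adjacent iff they are neighbors (connectivity is the same whether one uses this undirected graph or its directed version with antiparallel edges and loops). For a string $s$, $\Pi_k(s)$ is the set of Parikh vectors of all length-$k$ substrings of $s$. A set $\Pi$ of order-$k$ Parikh vectors is realizable if there is a string $s$ over $\Sigma$ with $\Pi_k(s)=\Pi$. -}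

module Defs where

open import Data.Nat using (ℕ; zero; suc; _+_; _≤_)
open import Data.Fin using (Fin)
open import Data.Bool using (if_then_else_)
open import Data.Fin.Properties using (_≟_)
open import Data.List using (List; []; _∷_; _++_; length)
open import Data.List.Membership.Propositional using (_∈_)
open import Data.List.Relation.Unary.All using (All)
open import Data.Vec using (Vec; tabulate; zipWith; lookup)
import Data.Vec as V
open import Data.Product using (Σ; ∃; ∃-syntax; _×_; _,_)
open import Relation.Nullary using (¬_; does)
open import Relation.Binary.PropositionalEquality using (_≡_)
open import Function.Bundles using (_⇔_)

Str : ℕ → Set
Str σ = List (Fin σ)

PVec : ℕ → Set
PVec σ = Vec ℕ σ

occ : ∀ {σ} → Fin σ → Str σ → ℕ
occ a [] = 0
occ a (b ∷ u) = (if does (a ≟ b) then 1 else 0) + occ a u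

pv : ∀ {σ} → Str σ → PVec σ
pv u = tabulate (λ i → occ i u)

order : ∀ {σ} → PVec σ → ℕ
order = V.sum

e : ∀ {σ} → Fin σ → PVec σ
e i = pv (i ∷ [])

_⊕_ : ∀ {σ} → PVec σ → PVec σ → PVec σ
_⊕_ = zipWith _+_

-- p, q neighbours iff q = p - e_i + e_j for some i ≠ j
-- (with all entries natural numbers: p = r + e_i, q = r + e_j)
Neighbors : ∀ {σ} → PVec σ → PVec σ → Set
Neighbors {σ} p q =
  Σ (Fin σ) λ i → Σ (Fin σ) λ j → ¬ (i ≡ j) ×
    Σ (PVec σ) λ r → (p ≡ r ⊕ e i) × (q ≡ r ⊕ e j)

InΠk : ∀ {σ} → ℕ → Str σ → PVec σ → Set
InΠk {σ} k s p =
  Σ (Str σ) λ x → Σ (Str σ) λ v → Σ (Str σ) λ y →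
    (s ≡ x ++ v ++ y) × (length v ≡ k) × (pv v ≡ p)

Realizable : ∀ {σ} → ℕ → List (PVec σ) → Set
Realizable {σ} k Π = Σ (Str σ) λ s → ∀ p → (InΠk k s p ⇔ (p ∈ Π))

data Walk {σ} (Π : List (PVec σ)) : PVec σ → PVec σ → Set where
  here : ∀ {p} → p ∈ Π → Walk Π p p
  step : ∀ {p r q} → p ∈ Π → Neighbors p r → Walk Π r q → Walk Π p q

Connected : ∀ {σ} → List (PVec σ) → Set
Connected Π = ∀ p q → p ∈ Π → q ∈ Π → Walk Π p q

OrderK : ∀ {σ} → ℕ → List (PVec σ) → Set
OrderK k Π = All (λ p → order p ≡ k) Π

-- A string realizing Π has all its length-k windows in Π, and consecutive windows
-- c w and w b have equal Parikh vectors (c = b) or are neighbors (c ≠ b), so sliding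
-- the window along the string walks inside Π.
-- Conversely, grow a string to the left while keeping every window in Π.  Prepending
-- the last letter of the first window rotates that window, keeping its Parikh vector;
-- so a letter i of the first window can be rotated to its end, after which prepending
-- j turns the first window's Parikh vector p into p - e_i + e_j.  Following walks from
-- the current first window to every vector of Π makes each of them a window.
module Submission where

open import Defs
open import Data.Nat using (ℕ; zero; suc; _+_; _≤_; _<_; z≤n; s≤s)
open import Data.Nat.Properties
  using ( suc-injective; +-comm; +-assoc; +-cancelʳ-≡; m≤m+n; m≤n+m; m≤n⇒m⊓n≡m; ≤-reflexive; <⇒≱
        ; module ≤-Reasoning)
open import Data.Fin using (Fin; zero; suc)
open import Data.Fin.Properties using (_≟_)
open import Data.Bool using (if_then_else_)
open import Data.List using (List; []; _∷_; _++_; length; replicate; map; take; drop)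
open import Data.List.Properties
  using ( ++-assoc; ++-identityʳ; ∷-injective; length-++; length-replicate; length-map; length-take
        ; take++drop≡id)
open import Data.List.Membership.Propositional using (_∈_)
open import Data.List.Membership.Propositional.Properties using (∈-∃++)
open import Data.List.Relation.Unary.Any using (here; there)
open import Data.List.Relation.Unary.All using (_∷_)
open import Data.Vec using (Vec; tabulate; zipWith; lookup; _∷_; [])
open import Data.Vec.Properties using (zipWith-comm; lookup-zipWith; lookup∘tabulate; tabulate-cong)
import Data.Vec.Properties as Vec
open import Data.Product using (Σ-syntax; _×_; _,_; proj₂)
open import Data.Empty using (⊥-elim)
open import Relation.Nullary using (¬_; yes; no)
open import Relation.Nullary.Decidable using (dec-true)
open import Relation.Binary.PropositionalEquality
open import Function.Base using (_∘_)
open import Function.Bundles using (_⇔_; mk⇔; Equivalence)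

++-prefix-unique : ∀ {A : Set} (xs ys us vs : List A) →
  xs ++ ys ≡ us ++ vs → length xs ≡ length us → xs ≡ us
++-prefix-unique []       ys []       vs eq ℓ = refl
++-prefix-unique (x ∷ xs) ys (u ∷ us) vs eq ℓ with ∷-injective eq
... | refl , eq′ = cong (x ∷_) (++-prefix-unique xs ys us vs eq′ (suc-injective ℓ))

length-++-∷ : ∀ {A : Set} (u : List A) a t → length (u ++ a ∷ t) ≡ suc (length (t ++ u))
length-++-∷ u a t = begin
  length (u ++ a ∷ t)       ≡⟨ length-++ u ⟩
  length u + suc (length t) ≡⟨ +-comm (length u) _ ⟩
  suc (length t + length u) ≡⟨ cong suc (length-++ t) ⟨
  suc (length (t ++ u))     ∎
  where open ≡-Reasoning

++-rotate : ∀ {A : Set} (t u : List A) a z → t ++ (u ++ a ∷ t) ++ z ≡ (t ++ u) ++ a ∷ t ++ z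
++-rotate t u a z = trans (cong (t ++_) (++-assoc u (a ∷ t) z)) (sym (++-assoc t u (a ∷ t ++ z)))

zipWith-tabulate : ∀ {n} (f g : Fin n → ℕ) →
  zipWith _+_ (tabulate f) (tabulate g) ≡ tabulate (λ i → f i + g i)
zipWith-tabulate {zero}  f g = refl
zipWith-tabulate {suc n} f g = cong (f zero + g zero ∷_) (zipWith-tabulate (f ∘ suc) (g ∘ suc))

+-cancelʳ-zipWith : ∀ {n} (p q r : Vec ℕ n) → zipWith _+_ p r ≡ zipWith _+_ q r → p ≡ q
+-cancelʳ-zipWith []       []       []       _  = refl
+-cancelʳ-zipWith (x ∷ p) (y ∷ q) (z ∷ r) eq with Vec.∷-injective eq
... | x+z≡y+z , eq′ = cong₂ _∷_ (+-cancelʳ-≡ z x y x+z≡y+z) (+-cancelʳ-zipWith p q r eq′)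

module _ {σ : ℕ} where

  occ-++ : (a : Fin σ) (u v : Str σ) → occ a (u ++ v) ≡ occ a u + occ a v
  occ-++ a []      v = refl
  occ-++ a (b ∷ u) v = trans (cong (_ +_) (occ-++ a u v)) (sym (+-assoc _ (occ a u) (occ a v)))

  occ-self : (a : Fin σ) → occ a (a ∷ []) ≡ 1
  occ-self a = cong (λ b → (if b then 1 else 0) + 0) (dec-true (a ≟ a) refl)

  lookup-pv : (u : Str σ) (a : Fin σ) → lookup (pv u) a ≡ occ a u
  lookup-pv u = lookup∘tabulate (λ a → occ a u)

  pv-++ : (u v : Str σ) → pv (u ++ v) ≡ pv u ⊕ pv v
  pv-++ u v = trans (tabulate-cong (λ a → occ-++ a u v)) (sym (zipWith-tabulate _ _))

  ⊕-comm : (p q : PVec σ) → p ⊕ q ≡ q ⊕ p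
  ⊕-comm = zipWith-comm +-comm

  pv-++-comm : (u v : Str σ) → pv (u ++ v) ≡ pv (v ++ u)
  pv-++-comm u v = trans (pv-++ u v) (trans (⊕-comm (pv u) (pv v)) (sym (pv-++ v u)))

  pv-∷ : (a : Fin σ) (u : Str σ) → pv (a ∷ u) ≡ pv u ⊕ e a
  pv-∷ a u = trans (pv-++-comm (a ∷ []) u) (pv-++ u (a ∷ []))

  ∈-of-pv : (a : Fin σ) (u : Str σ) (ρ : PVec σ) → pv u ≡ ρ ⊕ e a → a ∈ u
  ∈-of-pv a u ρ eq = occ-pos u (subst (1 ≤_) (sym occ≡) (m≤n+m 1 (lookup ρ a)))
    where
    occ≡ : occ a u ≡ lookup ρ a + 1
    occ≡ = begin
      occ a u                        ≡⟨ lookup-pv u a ⟨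
      lookup (pv u) a                ≡⟨ cong (λ v → lookup v a) eq ⟩
      lookup (ρ ⊕ e a) a             ≡⟨ lookup-zipWith _+_ a ρ (e a) ⟩
      lookup ρ a + lookup (e a) a    ≡⟨ cong (lookup ρ a +_) (lookup-pv (a ∷ []) a) ⟩
      lookup ρ a + occ a (a ∷ [])    ≡⟨ cong (lookup ρ a +_) (occ-self a) ⟩
      lookup ρ a + 1                 ∎
      where open ≡-Reasoning
    occ-pos : ∀ w → 1 ≤ occ a w → a ∈ w
    occ-pos (b ∷ w) h with a ≟ b
    ... | yes refl = here refl
    ... | no _     = there (occ-pos w h)

spell : ∀ {σ} → PVec σ → Str σ
spell []      = []
spell (m ∷ p) = replicate m zero ++ map suc (spell p)

length-spell : ∀ {σ} (p : PVec σ) → length (spell p) ≡ order p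
length-spell []      = refl
length-spell (m ∷ p) =
  trans (length-++ (replicate m zero))
        (cong₂ _+_ (length-replicate m) (trans (length-map suc (spell p)) (length-spell p)))

pv-spell : ∀ {σ} (p : PVec σ) → pv (spell p) ≡ p
pv-spell []               = refl
pv-spell {suc σ} (m ∷ p) = cong₂ _∷_ occ-zero (trans (tabulate-cong occ-suc) (pv-spell p))
  where
  occ-zero-replicate : ∀ n → occ {suc σ} zero (replicate n zero) ≡ n
  occ-zero-replicate zero    = refl
  occ-zero-replicate (suc n) = cong suc (occ-zero-replicate n)
  occ-suc-replicate : ∀ (a : Fin σ) n → occ (suc a) (replicate n zero) ≡ 0
  occ-suc-replicate a zero    = refl
  occ-suc-replicate a (suc n) = occ-suc-replicate a n
  occ-zero-map : (u : Str σ) → occ zero (map suc u) ≡ 0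
  occ-zero-map []      = refl
  occ-zero-map (b ∷ u) = occ-zero-map u
  occ-suc-map : (a : Fin σ) (u : Str σ) → occ (suc a) (map suc u) ≡ occ a u
  occ-suc-map a []      = refl
  occ-suc-map a (b ∷ u) with a ≟ b
  ... | yes refl = cong suc (occ-suc-map a u)
  ... | no _     = occ-suc-map a u
  occ-zero : occ zero (replicate m zero ++ map suc (spell p)) ≡ m
  occ-zero = trans (occ-++ zero (replicate m zero) _)
                   (trans (cong₂ _+_ (occ-zero-replicate m) (occ-zero-map (spell p))) (+-comm m 0))
  occ-suc : ∀ a → occ (suc a) (replicate m zero ++ map suc (spell p)) ≡ occ a (spell p)
  occ-suc a = trans (occ-++ (suc a) (replicate m zero) _)
                    (cong₂ _+_ (occ-suc-replicate a m) (occ-suc-map a (spell p)))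

module _ {σ : ℕ} (k : ℕ) where

  private variable
    s : Str σ
    p : PVec σ

  PrefixWindow : Str σ → PVec σ → Set
  PrefixWindow s p = Σ[ v ∈ Str σ ] Σ[ z ∈ Str σ ] (s ≡ v ++ z) × (length v ≡ k) × (pv v ≡ p)

  prefix⇒InΠk : PrefixWindow s p → InΠk k s p
  prefix⇒InΠk (v , z , eq , ℓ , pe) = [] , v , z , eq , ℓ , pe

  InΠk-++ˡ : ∀ t → InΠk k s p → InΠk k (t ++ s) p
  InΠk-++ˡ t (x , v , y , refl , ℓ , pe) = t ++ x , v , y , sym (++-assoc t x (v ++ y)) , ℓ , pe

  InΠk⇒≤length : InΠk k s p → k ≤ length s
  InΠk⇒≤length (x , v , y , refl , refl , _) = begin
    length v                        ≤⟨ m≤m+n (length v) (length y) ⟩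
    length v + length y             ≡⟨ length-++ v ⟨
    length (v ++ y)                 ≤⟨ m≤n+m _ (length x) ⟩
    length x + length (v ++ y)      ≡⟨ length-++ x ⟨
    length (x ++ v ++ y)            ∎
    where open ≤-Reasoning

  no-window-shorter : length s < k → ¬ InΠk k s p
  no-window-shorter s<k w = <⇒≱ s<k (InΠk⇒≤length w)

module _ {σ : ℕ} {Π : List (PVec σ)} where

  private variable
    p q r : PVec σ

  Neighbors-sym : Neighbors p q → Neighbors q p
  Neighbors-sym (i , j , i≢j , ρ , p≡ , q≡) = j , i , i≢j ∘ sym , ρ , q≡ , p≡

  walk-source : Walk Π p q → p ∈ Π
  walk-source (here p∈)     = p∈
  walk-source (step p∈ _ _) = p∈

  walk-++ : Walk Π p q → Walk Π q r → Walk Π p r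
  walk-++ (here _)        w′ = w′
  walk-++ (step p∈ pq w) w′ = step p∈ pq (walk-++ w w′)

  walk-reverse : Walk Π p q → Walk Π q p
  walk-reverse (here p∈)       = here p∈
  walk-reverse (step p∈ pr w) =
    walk-++ (walk-reverse w) (step (walk-source w) (Neighbors-sym pr) (here p∈))

module Realization {σ : ℕ} (k′ : ℕ) (Π : List (PVec σ)) where

  k : ℕ
  k = suc k′

  Admissible : Str σ → Set
  Admissible s = ∀ p → InΠk k s p → p ∈ Π

  _⊆ʷ_ : Str σ → Str σ → Set
  s ⊆ʷ s′ = ∀ {p} → InΠk k s p → InΠk k s′ p

  private variable
    s : Str σ
    p q : PVec σ

  prefix∈Π : Admissible s → PrefixWindow k s p → p ∈ Π
  prefix∈Π adm pw = adm _ (prefix⇒InΠk k pw)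

  admissible-short : length s < k → Admissible s
  admissible-short s<k p w = ⊥-elim (no-window-shorter k s<k w)

  admissible-∷⁻ : ∀ c → Admissible (c ∷ s) → Admissible s
  admissible-∷⁻ c adm p (x , v , y , eq , ℓ , pe) = adm p (c ∷ x , v , y , cong (c ∷_) eq , ℓ , pe)

  admissible-∷ : ∀ c w z → s ≡ w ++ z → length w ≡ k′ → pv (c ∷ w) ∈ Π →
                 Admissible s → Admissible (c ∷ s)
  admissible-∷ c w z refl ℓ cw∈ adm p ([] , v , y , eq , ℓv , refl) =
    subst (_∈ Π) (cong pv (++-prefix-unique (c ∷ w) z v y eq (trans (cong suc ℓ) (sym ℓv)))) cw∈
  admissible-∷ c w z refl ℓ cw∈ adm p (_ ∷ x , v , y , eq , ℓv , pe) =
    adm p (x , v , y , proj₂ (∷-injective eq) , ℓv , pe)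

  walk-slide : ∀ c w b → pv (c ∷ w) ∈ Π → Walk Π (pv (w ++ b ∷ [])) q → Walk Π (pv (c ∷ w)) q
  walk-slide c w b cw∈ walk with c ≟ b
  ... | yes refl = subst (λ p → Walk Π p _) (pv-++-comm w (c ∷ [])) walk
  ... | no c≢b   = step cw∈ (c , b , c≢b , pv w , pv-∷ c w , pv-++ w (b ∷ [])) walk

  walk-from-prefix : ∀ v₀ z x v y → v₀ ++ z ≡ x ++ v ++ y → length v₀ ≡ k → length v ≡ k →
                     Admissible (v₀ ++ z) → Walk Π (pv v₀) (pv v)
  walk-from-prefix v₀ z [] v y eq ℓ₀ ℓ adm
    with refl ← ++-prefix-unique v₀ z v y eq (trans ℓ₀ (sym ℓ)) =
    here (adm _ ([] , v₀ , z , refl , ℓ₀ , refl))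
  walk-from-prefix (c ∷ w) z (_ ∷ x) v y eq ℓ₀ ℓ adm with refl , eq′ ← ∷-injective eq | z
  ... | [] = ⊥-elim (no-window-shorter k (≤-reflexive (trans (cong (suc ∘ length) (++-identityʳ w)) ℓ₀))
                                          (x , v , y , eq′ , ℓ , refl))
  ... | b ∷ z′ = walk-slide c w b (adm _ ([] , c ∷ w , b ∷ z′ , refl , ℓ₀ , refl))
    (walk-from-prefix (w ++ b ∷ []) z′ x v y (trans (++-assoc w _ z′) eq′)
      (trans (length-++-∷ w b []) (cong suc (suc-injective ℓ₀))) ℓ
      (subst Admissible (sym (++-assoc w _ z′)) (admissible-∷⁻ c adm)))

  windows-connected : Admissible s → InΠk k s p → InΠk k s q → Walk Π p q
  windows-connected {s} adm w@(x , v , y , eq , ℓ , refl) (x′ , v′ , y′ , eq′ , ℓ′ , refl) =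
    walk-++ (walk-reverse (from-prefix x v y eq ℓ)) (from-prefix x′ v′ y′ eq′ ℓ′)
    where
    s≡ : take k s ++ drop k s ≡ s
    s≡ = take++drop≡id k s
    from-prefix : ∀ x v y → s ≡ x ++ v ++ y → length v ≡ k → Walk Π (pv (take k s)) (pv v)
    from-prefix x v y eq ℓ =
      walk-from-prefix (take k s) (drop k s) x v y (trans s≡ eq)
        (trans (length-take k s) (m≤n⇒m⊓n≡m (InΠk⇒≤length k w))) ℓ (subst Admissible (sym s≡) adm)

  admissible-∷-rotate : ∀ w a z → s ≡ w ++ a ∷ z → length w ≡ k′ → Admissible s → Admissible (a ∷ s)
  admissible-∷-rotate w a z refl ℓ adm = admissible-∷ a w (a ∷ z) refl ℓ wa∈ adm
    where
    wa∈ : pv (a ∷ w) ∈ Π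
    wa∈ = subst (_∈ Π) (pv-++-comm w (a ∷ []))
            (adm _ ([] , w ++ a ∷ [] , z , sym (++-assoc w _ z) ,
                    trans (length-++-∷ w a []) (cong suc ℓ) , refl))

  admissible-++-rotate : ∀ t u {v z} → v ≡ u ++ t → length v ≡ k →
                         Admissible (v ++ z) → Admissible (t ++ v ++ z)
  admissible-++-rotate []      u       eq ℓ adm = adm
  admissible-++-rotate (a ∷ t) u {v} {z} eq ℓ adm =
    admissible-∷-rotate (t ++ u) a (t ++ z) (trans (cong (λ v → t ++ v ++ z) eq) (++-rotate t u a z)) ℓ′
      (admissible-++-rotate t (u ++ a ∷ []) (trans eq (sym (++-assoc u _ t))) ℓ adm)
    where
    ℓ′ : length (t ++ u) ≡ k′
    ℓ′ = suc-injective (trans (sym (length-++-∷ u a t)) (trans (cong length (sym eq)) ℓ))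

  Extension : Str σ → PVec σ → Set
  Extension s q = Σ[ s′ ∈ Str σ ] PrefixWindow k s′ q × Admissible s′ × s ⊆ʷ s′

  extend-step : PrefixWindow k s p → Admissible s → Neighbors p q → q ∈ Π → Extension s q
  extend-step (v , z , refl , ℓ , refl) adm (i , j , _ , ρ , v≡ , refl) q∈
    with u , t , refl ← ∈-∃++ (∈-of-pv i v ρ v≡) =
    j ∷ t ++ v ++ z ,
    (j ∷ t ++ u , i ∷ t ++ z , cong (j ∷_) (++-rotate t u i z) , cong suc ℓ′ , pv≡) ,
    admissible-∷ j (t ++ u) (i ∷ t ++ z) (++-rotate t u i z) ℓ′ (subst (_∈ Π) (sym pv≡) q∈)
      (admissible-++-rotate t (u ++ i ∷ []) (sym (++-assoc u _ t)) ℓ adm) ,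
    InΠk-++ˡ k (j ∷ t)
    where
    ℓ′ : length (t ++ u) ≡ k′
    ℓ′ = suc-injective (trans (sym (length-++-∷ u i t)) ℓ)
    pv-tu : pv (t ++ u) ≡ ρ
    pv-tu = +-cancelʳ-zipWith (pv (t ++ u)) ρ (e i) (begin
      pv (t ++ u) ⊕ e i   ≡⟨ pv-∷ i (t ++ u) ⟨
      pv (i ∷ t ++ u)     ≡⟨ pv-++-comm (i ∷ t) u ⟩
      pv (u ++ i ∷ t)     ≡⟨ v≡ ⟩
      ρ ⊕ e i             ∎)
      where open ≡-Reasoning
    pv≡ : pv (j ∷ t ++ u) ≡ ρ ⊕ e j
    pv≡ = trans (pv-∷ j (t ++ u)) (cong (_⊕ e j) pv-tu)

  extend-along : Walk Π p q → PrefixWindow k s p → Admissible s → Extension s q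
  extend-along (here _) pw adm = _ , pw , adm , λ w → w
  extend-along (step _ pr walk) pw adm
    with s₁ , pw₁ , adm₁ , s⊆s₁ ← extend-step pw adm pr (walk-source walk)
    with s₂ , pw₂ , adm₂ , s₁⊆s₂ ← extend-along walk pw₁ adm₁ =
    s₂ , pw₂ , adm₂ , s₁⊆s₂ ∘ s⊆s₁

  cover : Connected Π → ∀ L → (∀ {q} → q ∈ L → q ∈ Π) → PrefixWindow k s p → Admissible s →
          Σ[ s′ ∈ Str σ ] Admissible s′ × s ⊆ʷ s′ × (∀ {q} → q ∈ L → InΠk k s′ q)
  cover conn [] _ _ adm = _ , adm , (λ w → w) , λ ()
  cover conn (q ∷ L) L⊆Π pw adm
    with s₁ , pw₁ , adm₁ , s⊆s₁ ← extend-along (conn _ q (prefix∈Π adm pw) (L⊆Π (here refl))) pw adm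
    with s₂ , adm₂ , s₁⊆s₂ , covers ← cover conn L (L⊆Π ∘ there) pw₁ adm₁ =
    s₂ , adm₂ , s₁⊆s₂ ∘ s⊆s₁ , λ { (here refl)   → s₁⊆s₂ (prefix⇒InΠk k pw₁)
                                 ; (there q∈L) → covers q∈L }

  admissible-window : ∀ w → length w ≡ k → pv w ∈ Π → Admissible w
  admissible-window (c ∷ w) ℓ cw∈ =
    admissible-∷ c w [] (sym (++-identityʳ w)) (suc-injective ℓ) cw∈ (admissible-short (≤-reflexive ℓ))

  realize : Connected Π → p ∈ Π → order p ≡ k → Realizable k Π
  realize {p} conn p∈ order≡ =
    let s , adm , _ , covers = cover conn Π (λ q∈ → q∈) seed (admissible-window (spell p) ℓ spell∈)
    in  s , λ q → mk⇔ (adm q) covers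
    where
    ℓ : length (spell p) ≡ k
    ℓ = trans (length-spell p) order≡
    spell∈ : pv (spell p) ∈ Π
    spell∈ = subst (_∈ Π) (sym (pv-spell p)) p∈
    seed : PrefixWindow k (spell p) p
    seed = spell p , [] , sym (++-identityʳ _) , ℓ , pv-spell p

realizable⇒connected : ∀ {σ} k (Π : List (PVec σ)) → Realizable (suc k) Π → Connected Π
realizable⇒connected k Π (s , realizes) p q p∈ q∈ =
  windows-connected (Equivalence.to ∘ realizes) (Equivalence.from (realizes p) p∈)
                                                (Equivalence.from (realizes q) q∈)
  where open Realization k Π

connected⇒realizable : ∀ {σ} k (Π : List (PVec σ)) → OrderK (suc k) Π → Connected Π →
                       Realizable (suc k) Π
connected⇒realizable k [] _ _ =
  [] , λ p → mk⇔ (⊥-elim ∘ no-window-shorter (suc k) (s≤s z≤n)) λ ()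
connected⇒realizable k Π@(_ ∷ _) (order≡ ∷ _) conn = realize conn (here refl) order≡
  where open Realization k Π

theorem2 : (k σ : ℕ) → 1 ≤ k → 1 ≤ σ → (Π : List (PVec σ)) → OrderK k Π →
    (Realizable k Π ⇔ Connected Π)
theorem2 zero    σ ()      _ Π _
theorem2 (suc k) σ (s≤s _) _ Π orderK =
  mk⇔ (realizable⇒connected k Π) (connected⇒realizable k Π orderK)
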